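{- Let $X$ be a finite non-empty set and $R$ a monotone transit function on $X$. Then $R$ satisfies (x) — for all $x,y,z\in X$, $R(x,y)\subseteq R(x,z)\cup R(z,y)$ — if and only if $R$ satisfies both (u) — for all $u,v,z\in X$, $z\in R(u,v)$ implies $R(u,v)=R(u,z)\cup R(z,v)$ — and (x') — for all $x,y,z\in X$, $z\notin R(x,y)$ implies $R(x,y)\subseteq R(x,z)\cup R(z,y)$.
   Context: A transit function on a finite non-empty set $X$ is a map $R:X\times X\to 2^X$ such that for all $u,v\in X$: $u\in R(u,v)$, $R(u,v)=R(v,u)$, and $R(u,u)=\{u\}$. $R$ is monotone if for all $u,v,p,q\in X$, $p,q\in R(u,v)$ implies $R(p,q)\subseteq R(u,v)$. -}

module Defs where

open import Data.Nat using (ℕ)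
open import Data.Fin using (Fin)
open import Data.Fin.Subset using (Subset; _∈_; _∉_; _⊆_; _∪_; ⁅_⁆)
open import Data.Product using (_×_)
open import Relation.Binary.PropositionalEquality using (_≡_)

TransitMap : ℕ → Set
TransitMap n = Fin n → Fin n → Subset n

IsTransit : ∀ {n} → TransitMap n → Set
IsTransit {n} R =
  (∀ (u v : Fin n) → u ∈ R u v) ×
  (∀ (u v : Fin n) → R u v ≡ R v u) ×
  (∀ (u : Fin n) → R u u ≡ ⁅ u ⁆)

Monotone : ∀ {n} → TransitMap n → Set
Monotone {n} R = ∀ (u v p q : Fin n) → p ∈ R u v → q ∈ R u v → R p q ⊆ R u v

AxiomX : ∀ {n} → TransitMap n → Set
AxiomX {n} R = ∀ (x y z : Fin n) → R x y ⊆ (R x z ∪ R z y)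

AxiomU : ∀ {n} → TransitMap n → Set
AxiomU {n} R = ∀ (u v z : Fin n) → z ∈ R u v → R u v ≡ (R u z ∪ R z v)

AxiomX' : ∀ {n} → TransitMap n → Set
AxiomX' {n} R = ∀ (x y z : Fin n) → z ∉ R x y → R x y ⊆ (R x z ∪ R z y)

{-# OPTIONS --safe #-}
-- For z ∈ R(u,v), monotonicity gives R(u,z) ∪ R(z,v) ⊆ R(u,v), since both
-- endpoints of each of these transit sets lie in R(u,v).  So (x) at such z is
-- exactly (u), and (x) at z ∉ R(x,y) is (x'); conversely (u) and (x') together
-- cover every z by deciding z ∈ R(x,y).
module Submission where

open import Defs
open import Data.Nat using (ℕ; suc)
open import Data.Fin.Subset using (Subset; _∈_; _⊆_; _∪_)
open import Data.Fin.Subset.Properties using (_∈?_; ⊆-antisym; ⊆-reflexive; x∈p∪q⁻)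
open import Data.Product using (_×_; _,_)
open import Data.Sum using ([_,_])
open import Function.Bundles using (_⇔_; mk⇔)
open import Relation.Nullary using (yes; no)
open import Relation.Binary.PropositionalEquality using (subst)

private
  variable
    n : ℕ

∪-least : {p q r : Subset n} → p ⊆ r → q ⊆ r → p ∪ q ⊆ r
∪-least {p = p} {q} p⊆r q⊆r x∈p∪q = [ p⊆r , q⊆r ] (x∈p∪q⁻ p q x∈p∪q)

module _ {R : TransitMap n} where

  transit-∈ʳ : IsTransit R → ∀ u v → v ∈ R u v
  transit-∈ʳ (∈ˡ , R-sym , _) u v = subst (v ∈_) (R-sym v u) (∈ˡ v u)

  monotone-∪-⊆ : IsTransit R → Monotone R →
                 ∀ {u v z} → z ∈ R u v → R u z ∪ R z v ⊆ R u v
  monotone-∪-⊆ transit@(∈ˡ , _) mono {u} {v} {z} z∈Ruv =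
    ∪-least (mono u v u z (∈ˡ u v) z∈Ruv)
            (mono u v z v z∈Ruv (transit-∈ʳ transit u v))

  axiomX⇒axiomU : IsTransit R → Monotone R → AxiomX R → AxiomU R
  axiomX⇒axiomU transit mono axX u v z z∈Ruv =
    ⊆-antisym (axX u v z) (monotone-∪-⊆ transit mono z∈Ruv)

  axiomX⇒axiomX' : AxiomX R → AxiomX' R
  axiomX⇒axiomX' axX x y z _ = axX x y z

  axiomU×axiomX'⇒axiomX : AxiomU R → AxiomX' R → AxiomX R
  axiomU×axiomX'⇒axiomX axU axX' x y z with z ∈? R x y
  ... | yes z∈Rxy = ⊆-reflexive (axU x y z z∈Rxy)
  ... | no  z∉Rxy = axX' x y z z∉Rxy

lemma8 : (n : ℕ) → (R : TransitMap (suc n)) → IsTransit R → Monotone R →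
    (AxiomX R ⇔ (AxiomU R × AxiomX' R))
lemma8 n R transit mono = mk⇔
  (λ axX → axiomX⇒axiomU transit mono axX , axiomX⇒axiomX' axX)
  (λ (axU , axX') → axiomU×axiomX'⇒axiomX axU axX')
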